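{- For every positive integer $n$, during a complete run of $\mathrm{AccelAsc}(n)$, the only read statement "$x\leftarrow a_k+1$" is executed exactly $p(n)-p(n-2)$ times.
   Context: $p(n)$ denotes the number of partitions of $n$, with the conventions $p(0)=1$ and $p(j)=0$ for $j<0$. The procedure $\mathrm{AccelAsc}(n)$, for $n\ge1$, operates on an array $a$ as follows and visits every ascending composition of $n$ (a sequence of positive integers in nondecreasing order summing to $n$) exactly once: 1. $k\leftarrow 2$; $a_1\leftarrow 0$; $y\leftarrow n-1$. 2. While $k\ne 1$: - $k\leftarrow k-1$; $x\leftarrow a_k+1$. - While $2x\le y$: $a_k\leftarrow x$; $y\leftarrow y-x$; $k\leftarrow k+1$. - $\ell\leftarrow k+1$. - While $x\le y$: $a_k\leftarrow x$; $a_\ell\leftarrow y$; visit $\langle a_1,\dots,a_\ell\rangle$; $x\leftarrow x+1$; $y\leftarrow y-1$. - $y\leftarrow y+x-1$; $a_k\leftarrow y+1$; visit $\langle a_1,\dots,a_k\rangle$. -}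

module Defs where

open import Data.Nat using (ℕ; zero; suc; _+_; _*_; _∸_; _≡ᵇ_; _≤ᵇ_)
open import Data.Bool using (Bool; true; false; if_then_else_)
open import Data.Maybe using (Maybe; just; nothing)
open import Data.List using (List; map; upTo)
open import Data.Nat.ListAction using (sum)

-- P n m = number of partitions of n into parts all ≤ m.
-- A partition with parts ≤ m+1 is determined by the multiplicity j of the
-- part m+1 (with j*(m+1) ≤ n) together with a partition of n - j*(m+1)
-- into parts ≤ m.
P : ℕ → ℕ → ℕ
P n zero    = if n ≡ᵇ 0 then 1 else 0
P n (suc m) = sum (map (λ j → if j * suc m ≤ᵇ n then P (n ∸ j * suc m) m else 0)
                       (upTo (suc n)))

p : ℕ → ℕ
p n = P n n

p[n-2] : ℕ → ℕ
p[n-2] zero          = 0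
p[n-2] (suc zero)    = 0
p[n-2] (suc (suc m)) = p m

-- program points:
--   test2 : the test "k ≠ 1" of the outer while loop (step 2)
--   test3 : the test "2x ≤ y" of the first inner while loop
--   test4 : the test "x ≤ y" of the second inner while loop
--   halt  : the procedure has terminated
data PC : Set where
  test2 test3 test4 halt : PC

record State : Set where
  constructor mkState
  field
    pc    : PC
    k     : ℕ
    x     : ℕ
    y     : ℕ
    ℓ     : ℕ
    a     : ℕ → ℕ     -- the array a (indices from 1)
    reads : ℕ         -- number of executions of "x ← a_k + 1" so far

upd : (ℕ → ℕ) → ℕ → ℕ → (ℕ → ℕ)
upd a i v j = if j ≡ᵇ i then v else a j

-- initial state after step 1: k ← 2; a_1 ← 0; y ← n - 1
-- (cells other than a_1 are uninitialised; we set them to 0, they are never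
--  read before being written)
initState : ℕ → State
initState n = mkState test2 2 0 (n ∸ 1) 0 (λ _ → 0) 0

-- one step of the procedure (visits have no effect on the state)
step : State → State
step (mkState test2 k x y ℓ a r) =
  if k ≡ᵇ 1
  then mkState halt k x y ℓ a r
  else mkState test3 (k ∸ 1) (a (k ∸ 1) + 1) y ℓ a (suc r)
         -- k ← k-1; x ← a_k + 1   (the read statement)
step (mkState test3 k x y ℓ a r) =
  if 2 * x ≤ᵇ y
  then mkState test3 (suc k) x (y ∸ x) ℓ (upd a k x) r
  else mkState test4 k x y (suc k) a r
step (mkState test4 k x y ℓ a r) =
  if x ≤ᵇ y
  then mkState test4 k (suc x) (y ∸ 1) ℓ (upd (upd a k x) ℓ y) r
  else mkState test2 k x (y + x ∸ 1) ℓ (upd a k (y + x ∸ 1 + 1)) r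
step s@(mkState halt _ _ _ _ _ _) = s

run : ℕ → State → Maybe State
run fuel (mkState halt k x y ℓ a r) = just (mkState halt k x y ℓ a r)
run zero s = nothing
run (suc fuel) s = run fuel (step s)

{-# OPTIONS --safe #-}
-- Let p≥ x r count the partitions of r into parts ≥ x. A stretch of the run
-- that completes a composition with remainder r and parts ≥ x either places
-- the part x, handles (x, r - x) recursively and then continues with (x + 1, r),
-- or, when r < 3x, finishes in the final loop. Charging each such stretch with
-- the read executed right after it, the stretch for (x, r) makes
-- p≥ x r - p≥ x (r - 2) reads: both terms obey p≥ x r = p≥ x (r - x) + p≥ (x + 1) r,
-- and when r < 3x a partition has at most two parts, whence
-- p≥ x r = 1 + p≥ x (r - 2) for the pairs that occur. The whole run is the
-- stretch for (1, n).
module Submission where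

open import Defs
open import Data.Nat
  using (ℕ; zero; suc; _+_; _*_; _∸_; _≤_; _<_; _≤ᵇ_; _≡ᵇ_; _≤?_; _≟_; z≤n; s≤s)
open import Data.Nat.Properties
open import Data.Nat.ListAction using (sum)
open import Data.Nat.Tactic.RingSolver using (solve-∀)
open import Algebra.Properties.CommutativeSemigroup +-commutativeSemigroup
  using (interchange)
open import Data.Bool using (if_then_else_)
open import Data.Bool.Properties using (if-cong; if-cong-then)
open import Data.List using (applyUpTo)
open import Data.List.Properties using (map-upTo)
open import Data.Maybe using (just)
open import Data.Product using (∃-syntax; _×_; _,_)
open import Data.Sum using (inj₁; inj₂)
open import Function using (_∘_; mk⇔)
open import Relation.Nullary.Negation using (¬_; contradiction)
open import Relation.Nullary.Decidable using (yes; no; dec-true; dec-false; does-⇔)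
open import Relation.Binary.PropositionalEquality
open ≡-Reasoning

sum-applyUpTo-cong : ∀ n {f g : ℕ → ℕ} → (∀ j → f j ≡ g j) →
  sum (applyUpTo f n) ≡ sum (applyUpTo g n)
sum-applyUpTo-cong zero    f≗g = refl
sum-applyUpTo-cong (suc n) f≗g = cong₂ _+_ (f≗g 0) (sum-applyUpTo-cong n (f≗g ∘ suc))

sum-applyUpTo-zero : ∀ n {f : ℕ → ℕ} → (∀ j → f j ≡ 0) → sum (applyUpTo f n) ≡ 0
sum-applyUpTo-zero zero    f≗0 = refl
sum-applyUpTo-zero (suc n) f≗0 = cong₂ _+_ (f≗0 0) (sum-applyUpTo-zero n (f≗0 ∘ suc))

sum-applyUpTo-+ : ∀ m n (f : ℕ → ℕ) →
  sum (applyUpTo f (m + n)) ≡ sum (applyUpTo f m) + sum (applyUpTo (λ j → f (m + j)) n)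
sum-applyUpTo-+ zero    n f = refl
sum-applyUpTo-+ (suc m) n f =
  trans (cong (f 0 +_) (sum-applyUpTo-+ m n (f ∘ suc))) (sym (+-assoc (f 0) _ _))

δ₀ : ℕ → ℕ
δ₀ n = if n ≡ᵇ 0 then 1 else 0

δ₀-pos : ∀ {n} → 0 < n → δ₀ n ≡ 0
δ₀-pos {suc n} _ = refl

-- The number of partitions of n into parts in [x, m] (x = 0 behaves as x = 1).
P≥ : ℕ → ℕ → ℕ → ℕ
P≥ x n zero    = δ₀ n
P≥ x n (suc m) =
  if x ≤ᵇ suc m
  then sum (applyUpTo (λ j → if j * suc m ≤ᵇ n then P≥ x (n ∸ j * suc m) m else 0) (suc n))
  else δ₀ n

P≥-one : ∀ n m → P≥ 1 n m ≡ P n m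
P≥-one n zero    = refl
P≥-one n (suc m) = trans
  (sum-applyUpTo-cong (suc n) λ j → if-cong-then (j * suc m ≤ᵇ n) {y = 0} (P≥-one (n ∸ j * suc m) m))
  (sym (cong sum (map-upTo term (suc n))))
  where
  term : ℕ → ℕ
  term j = if j * suc m ≤ᵇ n then P (n ∸ j * suc m) m else 0

P≥-above-max : ∀ {x} n m → m < x → P≥ x n m ≡ δ₀ n
P≥-above-max     n zero    _   = refl
P≥-above-max {x} n (suc m) m<x = if-cong (dec-false (x ≤? suc m) (<⇒≱ m<x))

P≥-unfold : ∀ {x} n m → x ≤ suc m →
  P≥ x n (suc m) ≡
  P≥ x n m + sum (applyUpTo (λ j → if suc j * suc m ≤ᵇ n then P≥ x (n ∸ suc j * suc m) m else 0) n)
P≥-unfold {x} n m x≤sm = if-cong (dec-true (x ≤? suc m) x≤sm)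

P≥-drop-max : ∀ {x} n m → n < suc m → P≥ x n (suc m) ≡ P≥ x n m
P≥-drop-max {x} n m n<sm with x ≤? suc m
... | yes x≤sm = begin
  P≥ x n (suc m)                  ≡⟨ P≥-unfold n m x≤sm ⟩
  P≥ x n m + sum (applyUpTo _ n)  ≡⟨ cong (P≥ x n m +_) (sum-applyUpTo-zero n too-large) ⟩
  P≥ x n m + 0                    ≡⟨ +-identityʳ _ ⟩
  P≥ x n m                        ∎
  where
  too-large : ∀ j → (if suc j * suc m ≤ᵇ n then P≥ x (n ∸ suc j * suc m) m else 0) ≡ 0
  too-large j = if-cong (dec-false (suc j * suc m ≤? n)
    λ le → <⇒≱ n<sm (≤-trans (m≤m+n (suc m) (j * suc m)) le))
... | no x≰sm = trans (P≥-above-max n (suc m) (≰⇒> x≰sm))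
                      (sym (P≥-above-max n m (<-trans (n<1+n m) (≰⇒> x≰sm))))

P≥-largest : ∀ {x} m d → x ≤ suc m →
  P≥ x (suc m + d) (suc m) ≡ P≥ x (suc m + d) m + P≥ x d (suc m)
P≥-largest {x} m d x≤sm = begin
  P≥ x (s + d) (suc m)                               ≡⟨ P≥-unfold (s + d) m x≤sm ⟩
  P≥ x (s + d) m + sum (applyUpTo with-part (s + d)) ≡⟨ cong (P≥ x (s + d) m +_) shift ⟩
  P≥ x (s + d) m + sum (applyUpTo rest (suc d))      ≡⟨ cong (P≥ x (s + d) m +_) (P≥-unfold d m x≤sm) ⟨
  P≥ x (s + d) m + P≥ x d (suc m)                    ∎
  where
  s : ℕ
  s = suc m
  with-part rest : ℕ → ℕ
  with-part j = if suc j * s ≤ᵇ s + d then P≥ x (s + d ∸ suc j * s) m else 0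
  rest j = if j * s ≤ᵇ d then P≥ x (d ∸ j * s) m else 0
  removing-one-part : ∀ j → with-part j ≡ rest j
  removing-one-part j = trans
    (if-cong (does-⇔ (mk⇔ (+-cancelˡ-≤ s _ _) (+-monoʳ-≤ s)) (s + j * s ≤? s + d) (j * s ≤? d)))
    (if-cong-then (j * s ≤ᵇ d) {y = 0} (cong (λ n → P≥ x n m) ([m+n]∸[m+o]≡n∸o s d (j * s))))
  too-large : ∀ j → with-part (suc d + j) ≡ 0
  too-large j = if-cong (dec-false (suc (suc d + j) * s ≤? s + d) λ le →
    <⇒≱ (≤-trans (m≤m+n (suc d) j) (m≤m*n (suc d + j) s)) (+-cancelˡ-≤ s _ _ le))
  shift : sum (applyUpTo with-part (s + d)) ≡ sum (applyUpTo rest (suc d))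
  shift = begin
    sum (applyUpTo with-part (s + d))        ≡⟨ cong (sum ∘ applyUpTo with-part) (cong suc (+-comm m d)) ⟩
    sum (applyUpTo with-part (suc d + m))    ≡⟨ sum-applyUpTo-+ (suc d) m with-part ⟩
    sum (applyUpTo with-part (suc d)) + sum (applyUpTo (λ j → with-part (suc d + j)) m)
      ≡⟨ cong₂ _+_ (sum-applyUpTo-cong (suc d) removing-one-part) (sum-applyUpTo-zero m too-large) ⟩
    sum (applyUpTo rest (suc d)) + 0         ≡⟨ +-identityʳ _ ⟩
    sum (applyUpTo rest (suc d))             ∎

P≥-largest-∸ : ∀ {x} m n → x ≤ suc m → suc m ≤ n →
  P≥ x n (suc m) ≡ P≥ x n m + P≥ x (n ∸ suc m) (suc m)
P≥-largest-∸ {x} m n x≤sm sm≤n =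
  subst (λ k → P≥ x k (suc m) ≡ P≥ x k m + P≥ x (n ∸ suc m) (suc m))
        (m+[n∸m]≡n sm≤n) (P≥-largest m (n ∸ suc m) x≤sm)

P≥-below-min : ∀ {x} n m → n < x → P≥ x n m ≡ δ₀ n
P≥-below-min     n zero    _   = refl
P≥-below-min {x} n (suc m) n<x with x ≤? suc m
... | yes x≤sm = trans (P≥-drop-max n m (<-≤-trans n<x x≤sm)) (P≥-below-min n m n<x)
... | no  x≰sm = P≥-above-max n (suc m) (≰⇒> x≰sm)

P≥-stable : ∀ {x} n m → n ≤ m → P≥ x n m ≡ P≥ x n n
P≥-stable n zero    z≤n = refl
P≥-stable n (suc m) n≤sm with m≤n⇒m<n∨m≡n n≤sm
... | inj₁ n<sm = trans (P≥-drop-max n m n<sm) (P≥-stable n m (≤-pred n<sm))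
... | inj₂ refl = refl

P≥-smallest-at-max : ∀ m n → suc m ≤ n →
  P≥ (suc m) n (suc m) ≡ P≥ (suc m) (n ∸ suc m) (suc m) + P≥ (suc (suc m)) n (suc m)
P≥-smallest-at-max m n sm≤n = begin
  P≥ (suc m) n (suc m)                                ≡⟨ P≥-largest-∸ m n ≤-refl sm≤n ⟩
  P≥ (suc m) n m + P≥ (suc m) (n ∸ suc m) (suc m)     ≡⟨ cong (_+ P≥ (suc m) (n ∸ suc m) (suc m)) no-smaller-parts ⟩
  P≥ (suc m) (n ∸ suc m) (suc m)                      ≡⟨ +-identityʳ _ ⟨
  P≥ (suc m) (n ∸ suc m) (suc m) + 0                  ≡⟨ cong (P≥ (suc m) (n ∸ suc m) (suc m) +_) no-larger-parts ⟨
  P≥ (suc m) (n ∸ suc m) (suc m) + P≥ (suc (suc m)) n (suc m) ∎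
  where
  no-smaller-parts : P≥ (suc m) n m ≡ 0
  no-smaller-parts = trans (P≥-above-max n m ≤-refl) (δ₀-pos (≤-trans (s≤s z≤n) sm≤n))
  no-larger-parts : P≥ (suc (suc m)) n (suc m) ≡ 0
  no-larger-parts = trans (P≥-above-max n (suc m) ≤-refl) (δ₀-pos (≤-trans (s≤s z≤n) sm≤n))

∸-swap-≤ : ∀ {m k n} → k ≤ n → m ≤ n ∸ k → k ≤ n ∸ m
∸-swap-≤ {m} {k} {n} k≤n m≤n-k =
  m+n≤o⇒m≤o∸n k (subst (_≤ n) (+-comm m k) (m≤o∸n⇒m+n≤o m k≤n m≤n-k))

P≥-smallest-rest-large : ∀ {x} m n → x ≤ m → suc m ≤ n → x ≤ n ∸ suc m →
  P≥ x n m ≡ P≥ x (n ∸ x) m + P≥ (suc x) n m →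
  P≥ x (n ∸ suc m) (suc m) ≡ P≥ x (n ∸ suc m ∸ x) (suc m) + P≥ (suc x) (n ∸ suc m) (suc m) →
  P≥ x n (suc m) ≡ P≥ x (n ∸ x) (suc m) + P≥ (suc x) n (suc m)
P≥-smallest-rest-large {x} m n x≤m sm≤n x≤rest split-below split-rest = begin
  P≥ x n (suc m)
    ≡⟨ P≥-largest-∸ m n x≤sm sm≤n ⟩
  P≥ x n m + P≥ x (n ∸ suc m) (suc m)
    ≡⟨ cong₂ _+_ split-below split-rest ⟩
  (P≥ x (n ∸ x) m + P≥ (suc x) n m) + (P≥ x (n ∸ suc m ∸ x) (suc m) + larger-rest)
    ≡⟨ interchange (P≥ x (n ∸ x) m) (P≥ (suc x) n m) (P≥ x (n ∸ suc m ∸ x) (suc m)) larger-rest ⟩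
  (P≥ x (n ∸ x) m + P≥ x (n ∸ suc m ∸ x) (suc m)) + (P≥ (suc x) n m + larger-rest)
    ≡⟨ cong (λ k → (P≥ x (n ∸ x) m + P≥ x k (suc m)) + (P≥ (suc x) n m + larger-rest)) reorder ⟩
  (P≥ x (n ∸ x) m + P≥ x (n ∸ x ∸ suc m) (suc m)) + (P≥ (suc x) n m + larger-rest)
    ≡⟨ cong₂ _+_ (P≥-largest-∸ m (n ∸ x) x≤sm (∸-swap-≤ sm≤n x≤rest))
                 (P≥-largest-∸ m n (s≤s x≤m) sm≤n) ⟨
  P≥ x (n ∸ x) (suc m) + P≥ (suc x) n (suc m) ∎
  where
  larger-rest : ℕ
  larger-rest = P≥ (suc x) (n ∸ suc m) (suc m)
  x≤sm : x ≤ suc m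
  x≤sm = ≤-trans x≤m (n≤1+n m)
  reorder : n ∸ suc m ∸ x ≡ n ∸ x ∸ suc m
  reorder = trans (∸-+-assoc n (suc m) x)
                  (trans (cong (n ∸_) (+-comm (suc m) x)) (sym (∸-+-assoc n x (suc m))))

P≥-smallest-rest-small : ∀ {x} m n → x ≤ m → suc m ≤ n → n ∸ suc m < x →
  P≥ x n m ≡ P≥ x (n ∸ x) m + P≥ (suc x) n m →
  P≥ x n (suc m) ≡ P≥ x (n ∸ x) (suc m) + P≥ (suc x) n (suc m)
P≥-smallest-rest-small {x} m n x≤m sm≤n rest<x split-below = begin
  P≥ x n (suc m)
    ≡⟨ P≥-largest-∸ m n x≤sm sm≤n ⟩
  P≥ x n m + P≥ x (n ∸ suc m) (suc m)
    ≡⟨ cong₂ _+_ split-below (P≥-below-min (n ∸ suc m) (suc m) rest<x) ⟩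
  (P≥ x (n ∸ x) m + P≥ (suc x) n m) + δ₀ (n ∸ suc m)
    ≡⟨ +-assoc (P≥ x (n ∸ x) m) (P≥ (suc x) n m) (δ₀ (n ∸ suc m)) ⟩
  P≥ x (n ∸ x) m + (P≥ (suc x) n m + δ₀ (n ∸ suc m))
    ≡⟨ cong₂ _+_ (P≥-drop-max (n ∸ x) m n-x<sm)
                 (cong (P≥ (suc x) n m +_) (P≥-below-min (n ∸ suc m) (suc m) (m<n⇒m<1+n rest<x))) ⟨
  P≥ x (n ∸ x) (suc m) + (P≥ (suc x) n m + P≥ (suc x) (n ∸ suc m) (suc m))
    ≡⟨ cong (P≥ x (n ∸ x) (suc m) +_) (P≥-largest-∸ m n (s≤s x≤m) sm≤n) ⟨
  P≥ x (n ∸ x) (suc m) + P≥ (suc x) n (suc m) ∎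
  where
  x≤sm : x ≤ suc m
  x≤sm = ≤-trans x≤m (n≤1+n m)
  n-x<sm : n ∸ x < suc m
  n-x<sm = ≰⇒> λ sm≤n-x → <⇒≱ rest<x (∸-swap-≤ (≤-trans x≤sm sm≤n) sm≤n-x)

P≥-smallest : ∀ b {x} m n → n ≤ b → 1 ≤ x → x ≤ m → x ≤ n →
  P≥ x n m ≡ P≥ x (n ∸ x) m + P≥ (suc x) n m
P≥-smallest zero    m    n n≤0 1≤x _   x≤n = contradiction (≤-trans 1≤x (≤-trans x≤n n≤0)) λ ()
P≥-smallest (suc b) zero n _   1≤x x≤0 _   = contradiction (≤-trans 1≤x x≤0) λ ()
P≥-smallest (suc b) {x} (suc m) n n≤b 1≤x x≤sm x≤n with x ≤? m
... | no x≰m with ≤-antisym x≤sm (≰⇒> x≰m)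
...   | refl = P≥-smallest-at-max m n x≤n
P≥-smallest (suc b) {x} (suc m) n n≤b 1≤x x≤sm x≤n | yes x≤m with suc m ≤? n
... | yes sm≤n with x ≤? n ∸ suc m
...   | yes x≤rest = P≥-smallest-rest-large m n x≤m sm≤n x≤rest
  (P≥-smallest (suc b) m n n≤b 1≤x x≤m x≤n)
  (P≥-smallest b (suc m) (n ∸ suc m) (≤-trans (∸-monoʳ-≤ n (s≤s z≤n)) (∸-monoˡ-≤ 1 n≤b)) 1≤x x≤sm x≤rest)
...   | no x≰rest = P≥-smallest-rest-small m n x≤m sm≤n (≰⇒> x≰rest)
  (P≥-smallest (suc b) m n n≤b 1≤x x≤m x≤n)
P≥-smallest (suc b) {x} (suc m) n n≤b 1≤x x≤sm x≤n | yes x≤m | no sm≰n = begin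
  P≥ x n (suc m)                                ≡⟨ P≥-drop-max n m n<sm ⟩
  P≥ x n m                                      ≡⟨ P≥-smallest (suc b) m n n≤b 1≤x x≤m x≤n ⟩
  P≥ x (n ∸ x) m + P≥ (suc x) n m               ≡⟨ cong₂ _+_ (P≥-drop-max (n ∸ x) m (≤-<-trans (m∸n≤m n x) n<sm))
                                                             (P≥-drop-max n m n<sm) ⟨
  P≥ x (n ∸ x) (suc m) + P≥ (suc x) n (suc m)   ∎
  where
  n<sm : n < suc m
  n<sm = ≰⇒> sm≰n

p≥ : ℕ → ℕ → ℕ
p≥ x n = P≥ x n n

p≥[n-2] : ℕ → ℕ → ℕ
p≥[n-2] x zero          = 0
p≥[n-2] x (suc zero)    = 0
p≥[n-2] x (suc (suc n)) = p≥ x n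

p≥-one : ∀ n → p≥ 1 n ≡ p n
p≥-one n = P≥-one n n

p≥[n-2]-one : ∀ n → p≥[n-2] 1 n ≡ p[n-2] n
p≥[n-2]-one zero          = refl
p≥[n-2]-one (suc zero)    = refl
p≥[n-2]-one (suc (suc n)) = p≥-one n

p≥-below-min : ∀ {x n} → 0 < n → n < x → p≥ x n ≡ 0
p≥-below-min {n = n} 0<n n<x = trans (P≥-below-min n n n<x) (δ₀-pos 0<n)

p≥-smallest : ∀ {x} n → 1 ≤ x → p≥ x (x + n) ≡ p≥ x n + p≥ (suc x) (x + n)
p≥-smallest {x} n 1≤x = begin
  P≥ x (x + n) (x + n)                           ≡⟨ P≥-smallest (x + n) (x + n) (x + n) ≤-refl 1≤x x≤x+n x≤x+n ⟩
  P≥ x (x + n ∸ x) (x + n) + p≥ (suc x) (x + n)  ≡⟨ cong (_+ p≥ (suc x) (x + n)) smaller-remainder ⟩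
  p≥ x n + p≥ (suc x) (x + n)                    ∎
  where
  x≤x+n : x ≤ x + n
  x≤x+n = m≤m+n x n
  smaller-remainder : P≥ x (x + n ∸ x) (x + n) ≡ p≥ x n
  smaller-remainder = trans (cong (λ k → P≥ x k (x + n)) (m+n∸m≡n x n)) (P≥-stable n (x + n) (m≤n+m n x))

p≥[n-2]-smallest : ∀ {x y} → 1 ≤ x → 2 ≤ y →
  p≥[n-2] x (x + y) ≡ p≥[n-2] x y + p≥[n-2] (suc x) (x + y)
p≥[n-2]-smallest {y = suc zero} _ (s≤s ())
p≥[n-2]-smallest {x} {suc (suc n)} 1≤x _ rewrite +-suc x (suc n) | +-suc x n = p≥-smallest n 1≤x

p≥-one-part : ∀ {x} d → d < x → p≥ x (x + d) ≡ 1
p≥-one-part {x} zero 0<x = begin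
  p≥ x (x + 0)              ≡⟨ p≥-smallest 0 0<x ⟩
  suc (p≥ (suc x) (x + 0))  ≡⟨ cong suc (p≥-below-min (≤-trans 0<x (m≤m+n x 0)) (s≤s (≤-reflexive (+-identityʳ x)))) ⟩
  1                         ∎
p≥-one-part {x} (suc d) d<x = begin
  p≥ x (x + suc d)                         ≡⟨ p≥-smallest (suc d) (≤-trans (s≤s z≤n) d<x) ⟩
  p≥ x (suc d) + p≥ (suc x) (x + suc d)    ≡⟨ cong₂ _+_ (p≥-below-min (s≤s z≤n) d<x) (cong (p≥ (suc x)) (+-suc x d)) ⟩
  p≥ (suc x) (suc x + d)                   ≡⟨ p≥-one-part d (m<n⇒m<1+n (≤-trans (n≤1+n (suc d)) d<x)) ⟩
  1                                        ∎

p≥-one-with-smallest : ∀ {x} d → d < x → p≥ x (x + (x + d)) ≡ suc (p≥ (suc x) (x + (x + d)))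
p≥-one-with-smallest {x} d d<x = begin
  p≥ x (x + (x + d))                       ≡⟨ p≥-smallest (x + d) (≤-trans (s≤s z≤n) d<x) ⟩
  p≥ x (x + d) + p≥ (suc x) (x + (x + d))  ≡⟨ cong (_+ p≥ (suc x) (x + (x + d))) (p≥-one-part d d<x) ⟩
  suc (p≥ (suc x) (x + (x + d)))           ∎

p≥-at-most-two-parts-base : ∀ v d → d ≤ 1 →
  p≥ (2 + v) (2 + v + (2 + v + d)) ≡ suc (p≥[n-2] (2 + v) (2 + v + (2 + v + d)))
p≥-at-most-two-parts-base v d d≤1 = begin
  p≥ x (x + (x + d))                      ≡⟨ p≥-one-with-smallest {x} d (s≤s (≤-trans d≤1 (s≤s z≤n))) ⟩
  suc (p≥ (suc x) (x + (x + d)))          ≡⟨ cong (suc ∘ p≥ (suc x)) (shift v d) ⟩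
  suc (p≥ (suc x) (suc x + (suc v + d)))  ≡⟨ cong suc (p≥-one-part {suc x} (suc v + d) (s≤s (u+d≤1+u (suc v)))) ⟩
  2                                       ≡⟨ cong suc (p≥-one-part {x} (v + d) (s≤s (u+d≤1+u v))) ⟨
  suc (p≥ x (x + (v + d)))                ≡⟨ cong (suc ∘ p≥[n-2] x) (lower v d) ⟨
  suc (p≥[n-2] x (x + (x + d)))           ∎
  where
  x : ℕ
  x = 2 + v
  u+d≤1+u : ∀ u → u + d ≤ suc u
  u+d≤1+u u = ≤-trans (+-monoʳ-≤ u d≤1) (≤-reflexive (+-comm u 1))
  shift : ∀ v d → 2 + v + (2 + v + d) ≡ 3 + v + (1 + v + d)
  shift = solve-∀
  lower : ∀ v d → 2 + v + (2 + v + d) ≡ 2 + (2 + v + (v + d))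
  lower = solve-∀

p≥-at-most-two-parts : ∀ {x} d → d < x → p≥ x (x + (x + d)) ≡ suc (p≥[n-2] x (x + (x + d)))
p≥-at-most-two-parts {suc zero}    zero          _ = refl
p≥-at-most-two-parts {suc zero}    (suc zero)    (s≤s ())
p≥-at-most-two-parts {suc (suc v)} zero          _ = p≥-at-most-two-parts-base v 0 z≤n
p≥-at-most-two-parts {suc (suc v)} (suc zero)    _ = p≥-at-most-two-parts-base v 1 ≤-refl
p≥-at-most-two-parts {x}           (suc (suc e)) e+2<x = begin
  p≥ x (x + (x + (2 + e)))                        ≡⟨ p≥-one-with-smallest {x} (2 + e) e+2<x ⟩
  suc (p≥ (suc x) (x + (x + (2 + e))))            ≡⟨ cong (suc ∘ p≥ (suc x)) (shift x e) ⟩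
  suc (p≥ (suc x) (suc x + (suc x + e)))          ≡⟨ cong suc (p≥-at-most-two-parts {suc x} e (<-trans e<x (n<1+n x))) ⟩
  suc (suc (p≥[n-2] (suc x) (suc x + (suc x + e)))) ≡⟨ cong (suc ∘ suc ∘ p≥[n-2] (suc x)) (lower-next x e) ⟩
  suc (suc (p≥ (suc x) (x + (x + e))))            ≡⟨ cong suc (p≥-one-with-smallest {x} e e<x) ⟨
  suc (p≥ x (x + (x + e)))                        ≡⟨ cong (suc ∘ p≥[n-2] x) (lower x e) ⟨
  suc (p≥[n-2] x (x + (x + (2 + e))))             ∎
  where
  e<x : e < x
  e<x = ≤-trans (n≤1+n (suc e)) (≤-trans (n≤1+n (suc (suc e))) e+2<x)
  shift : ∀ x e → x + (x + (2 + e)) ≡ suc x + (suc x + e)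
  shift = solve-∀
  lower-next : ∀ x e → suc x + (suc x + e) ≡ 2 + (x + (x + e))
  lower-next = solve-∀
  lower : ∀ x e → x + (x + (2 + e)) ≡ 2 + (x + (x + e))
  lower = solve-∀

-- The pairs (x, r) on which the first inner loop is entered: r ≥ 2x, except at
-- the root for n = 1 and after the part 1 with remainder 3.
data Admissible : ℕ → ℕ → Set where
  twice≤    : ∀ {x r} → 2 * x ≤ r → Admissible x r
  one-one   : Admissible 1 1
  two-three : Admissible 2 3

p≥-admissible-small : ∀ {x r} → Admissible x r → r < 3 * x → p≥ x r ≡ suc (p≥[n-2] x r)
p≥-admissible-small one-one   _ = refl
p≥-admissible-small two-three _ = refl
p≥-admissible-small {x} {r} (twice≤ 2x≤r) r<3x =
  subst (λ r → p≥ x r ≡ suc (p≥[n-2] x r)) window (p≥-at-most-two-parts (r ∸ 2 * x) d<x)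
  where
  window : x + (x + (r ∸ 2 * x)) ≡ r
  window = trans (double x (r ∸ 2 * x)) (m+[n∸m]≡n 2x≤r)
    where
    double : ∀ x d → x + (x + d) ≡ 2 * x + d
    double = solve-∀
  d<x : r ∸ 2 * x < x
  d<x = subst (r ∸ 2 * x <_) (m+n∸m≡n (2 * x) x) (∸-monoˡ-< (subst (r <_) (+-comm x (2 * x)) r<3x) 2x≤r)

p≥-excess-smallest : ∀ {x y t u} → 1 ≤ x → 2 * x ≤ y →
  suc t + p≥[n-2] x y ≡ p≥ x y →
  suc u + p≥[n-2] (suc x) (x + y) ≡ p≥ (suc x) (x + y) →
  suc (suc (t + u)) + p≥[n-2] x (x + y) ≡ p≥ x (x + y)
p≥-excess-smallest {x} {y} {t} {u} 1≤x 2x≤y excess-x excess-sx = begin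
  suc (suc (t + u)) + p≥[n-2] x (x + y)
    ≡⟨ cong (suc (suc (t + u)) +_) (p≥[n-2]-smallest 1≤x 2≤y) ⟩
  suc (suc (t + u)) + (p≥[n-2] x y + p≥[n-2] (suc x) (x + y))
    ≡⟨ regroup t u (p≥[n-2] x y) (p≥[n-2] (suc x) (x + y)) ⟩
  (suc t + p≥[n-2] x y) + (suc u + p≥[n-2] (suc x) (x + y))
    ≡⟨ cong₂ _+_ excess-x excess-sx ⟩
  p≥ x y + p≥ (suc x) (x + y)
    ≡⟨ p≥-smallest y 1≤x ⟨
  p≥ x (x + y) ∎
  where
  2≤y : 2 ≤ y
  2≤y = ≤-trans (+-mono-≤ 1≤x (≤-trans 1≤x (m≤m+n x 0))) 2x≤y
  regroup : ∀ t u v w → suc (suc (t + u)) + (v + w) ≡ (suc t + v) + (suc u + w)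
  regroup = solve-∀

Admissible-next : ∀ {x y} → 1 ≤ x → 2 * x ≤ y → Admissible (suc x) (x + y)
Admissible-next {suc zero}    {suc (suc zero)}      _ _         = two-three
Admissible-next {suc zero}    {suc (suc (suc y))}   _ _         = twice≤ (s≤s (s≤s (s≤s (s≤s z≤n))))
Admissible-next {suc zero}    {suc zero}            _ (s≤s ())
Admissible-next {suc (suc x)} {y}                   _ 2x≤y      = twice≤
  (≤-trans (≤-reflexive (rearrange x))
    (≤-trans (+-monoˡ-≤ (2 * (2 + x)) (s≤s (s≤s z≤n))) (+-monoʳ-≤ (2 + x) 2x≤y)))
  where
  rearrange : ∀ x → 2 * (3 + x) ≡ 2 + 2 * (2 + x)
  rearrange = solve-∀

Admissible-root : ∀ n → Admissible 1 (suc n)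
Admissible-root zero    = one-one
Admissible-root (suc n) = twice≤ (s≤s (s≤s z≤n))

steps : ℕ → State → State
steps zero    s = s
steps (suc m) s = steps m (step s)

steps-+ : ∀ m m′ s → steps (m + m′) s ≡ steps m′ (steps m s)
steps-+ zero    m′ s = refl
steps-+ (suc m) m′ s = steps-+ m m′ (step s)

steps-halt : ∀ m {k x y ℓ a c} → steps m (mkState halt k x y ℓ a c) ≡ mkState halt k x y ℓ a c
steps-halt zero    = refl
steps-halt (suc m) = steps-halt m

run-halts : ∀ m s {k x y ℓ a c} →
  steps m s ≡ mkState halt k x y ℓ a c → run m s ≡ just (mkState halt k x y ℓ a c)
run-halts zero    s                              refl = refl
run-halts (suc m) (mkState halt  k x y ℓ a c) eq   = cong just (trans (sym (steps-halt m)) eq)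
run-halts (suc m) (mkState test2 k x y ℓ a c) eq   = run-halts m _ eq
run-halts (suc m) (mkState test3 k x y ℓ a c) eq   = run-halts m _ eq
run-halts (suc m) (mkState test4 k x y ℓ a c) eq   = run-halts m _ eq

upd-same : ∀ a i v → upd a i v i ≡ v
upd-same a i v = if-cong (dec-true (i ≟ i) refl)

upd-other : ∀ a {i} v {j} → ¬ j ≡ i → upd a i v j ≡ a j
upd-other a {i} v {j} j≢i = if-cong (dec-false (j ≟ i) j≢i)

module _ {k x y ℓ : ℕ} {a : ℕ → ℕ} {c : ℕ} where

  step-descend : 2 * x ≤ y →
    step (mkState test3 k x y ℓ a c) ≡ mkState test3 (suc k) x (y ∸ x) ℓ (upd a k x) c
  step-descend 2x≤y = if-cong (dec-true (2 * x ≤? y) 2x≤y)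

  step-to-pairs : ¬ 2 * x ≤ y → step (mkState test3 k x y ℓ a c) ≡ mkState test4 k x y (suc k) a c
  step-to-pairs 2x≰y = if-cong (dec-false (2 * x ≤? y) 2x≰y)

  step-pair : x ≤ y →
    step (mkState test4 k x y ℓ a c) ≡ mkState test4 k (suc x) (y ∸ 1) ℓ (upd (upd a k x) ℓ y) c
  step-pair x≤y = if-cong (dec-true (x ≤? y) x≤y)

  step-close : ¬ x ≤ y →
    step (mkState test4 k x y ℓ a c) ≡ mkState test2 k x (y + x ∸ 1) ℓ (upd a k (y + x ∸ 1 + 1)) c
  step-close x≰y = if-cong (dec-false (x ≤? y) x≰y)

record ReturnsTo (s : State) (k r : ℕ) (a : ℕ → ℕ) (c : ℕ) : Set where
  field
    duration : ℕ
    x′ y′ ℓ′ : ℕ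
    a′       : ℕ → ℕ
    reaches  : steps duration s ≡ mkState test2 k x′ y′ ℓ′ a′ c
    suc-y′   : suc y′ ≡ r
    a′-top   : a′ k ≡ r
    a′-below : ∀ j → j < k → a′ j ≡ a j

ReturnsTo-prefix : ∀ {s s₁ k r a a₁ c} m → steps m s ≡ s₁ →
  (∀ j → j < k → a₁ j ≡ a j) → ReturnsTo s₁ k r a₁ c → ReturnsTo s k r a c
ReturnsTo-prefix m s→s₁ a₁≗a R = record
  { duration = m + duration ; x′ = x′ ; y′ = y′ ; ℓ′ = ℓ′ ; a′ = a′
  ; reaches  = trans (steps-+ m duration _) (trans (cong (steps duration) s→s₁) reaches)
  ; suc-y′   = suc-y′
  ; a′-top   = a′-top
  ; a′-below = λ j j<k → trans (a′-below j j<k) (a₁≗a j j<k)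
  }
  where open ReturnsTo R

pair-loop : ∀ {k ℓ} y {x a c} → 1 ≤ x → k < ℓ →
  ReturnsTo (mkState test4 k x y ℓ a c) k (x + y) a c
pair-loop {k} {ℓ} y {x} {a} {c} 1≤x k<ℓ with x ≤? y
... | no x≰y = record
  { duration = 1 ; x′ = x ; y′ = y + x ∸ 1 ; ℓ′ = ℓ ; a′ = upd a k (y + x ∸ 1 + 1)
  ; reaches  = step-close x≰y
  ; suc-y′   = last-part
  ; a′-top   = trans (upd-same a k _) (trans (+-comm _ 1) last-part)
  ; a′-below = λ j j<k → upd-other a _ (<⇒≢ j<k)
  }
  where
  last-part : suc (y + x ∸ 1) ≡ x + y
  last-part = trans (m+[n∸m]≡n (≤-trans 1≤x (m≤n+m x y))) (+-comm y x)
pair-loop {k} {ℓ} zero    {x} 1≤x k<ℓ | yes x≤0 = contradiction (≤-trans 1≤x x≤0) λ ()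
pair-loop {k} {ℓ} (suc y) {x} {a} {c} 1≤x k<ℓ | yes x≤y =
  ReturnsTo-prefix 1 (step-pair x≤y) below
    (subst (λ r → ReturnsTo (mkState test4 k (suc x) y ℓ a′ c) k r a′ c) (sym (+-suc x y))
           (pair-loop y (s≤s z≤n) k<ℓ))
  where
  a′ : ℕ → ℕ
  a′ = upd (upd a k x) ℓ (suc y)
  below : ∀ j → j < k → a′ j ≡ a j
  below j j<k = trans (upd-other (upd a k x) _ (<⇒≢ (<-trans j<k k<ℓ))) (upd-other a _ (<⇒≢ j<k))

-- The suc is the read performed right after the run returns to level k.
SubtreeRun : State → ℕ → ℕ → ℕ → (ℕ → ℕ) → ℕ → Set
SubtreeRun s k x r a c = ∃[ t ] (ReturnsTo s k r a (c + t) × suc t + p≥[n-2] x r ≡ p≥ x r)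

subtree-leaf : ∀ {k x y ℓ a c} → 1 ≤ x → Admissible x (x + y) → ¬ 2 * x ≤ y →
  SubtreeRun (mkState test3 (suc k) x y ℓ a c) (suc k) x (x + y) a c
subtree-leaf {k} {x} {y} {ℓ} {a} {c} 1≤x adm 2x≰y =
  0 ,
  ReturnsTo-prefix 1 (step-to-pairs 2x≰y) (λ _ _ → refl)
    (subst (ReturnsTo (mkState test4 (suc k) x y (suc (suc k)) a c) (suc k) (x + y) a)
           (sym (+-identityʳ c)) (pair-loop y 1≤x ≤-refl)) ,
  sym (p≥-admissible-small adm (+-monoʳ-< x (≰⇒> 2x≰y)))

subtree-descend : ∀ {k x y ℓ a c} → 1 ≤ x → 2 * x ≤ y →
  SubtreeRun (mkState test3 (suc (suc k)) x (y ∸ x) ℓ (upd a (suc k) x) c)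
             (suc (suc k)) x y (upd a (suc k) x) c →
  (∀ {y₁ ℓ₁ a₁ c₁} → suc y₁ ≡ y →
     SubtreeRun (mkState test3 (suc k) (suc x) y₁ ℓ₁ a₁ c₁) (suc k) (suc x) (x + y) a₁ c₁) →
  SubtreeRun (mkState test3 (suc k) x y ℓ a c) (suc k) x (x + y) a c
subtree-descend {k} {x} {y} {ℓ} {a} {c} 1≤x 2x≤y (tC , C , countC) continue
  with continue (ReturnsTo.suc-y′ C)
... | tD , D , countD =
  suc (tC + tD) ,
  subst (ReturnsTo (mkState test3 (suc k) x y ℓ a c) (suc k) (x + y) a) reads-total
        (ReturnsTo-prefix (suc (duration + 1)) path below D) ,
  p≥-excess-smallest 1≤x 2x≤y countC countD
  where
  open ReturnsTo C
  path : steps (suc (duration + 1)) (mkState test3 (suc k) x y ℓ a c)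
         ≡ mkState test3 (suc k) (suc x) y′ ℓ′ a′ (suc (c + tC))
  path = begin
    steps (duration + 1) (step (mkState test3 (suc k) x y ℓ a c))
      ≡⟨ cong (steps (duration + 1)) (step-descend 2x≤y) ⟩
    steps (duration + 1) (mkState test3 (suc (suc k)) x (y ∸ x) ℓ (upd a (suc k) x) c)
      ≡⟨ steps-+ duration 1 _ ⟩
    step (steps duration (mkState test3 (suc (suc k)) x (y ∸ x) ℓ (upd a (suc k) x) c))
      ≡⟨ cong step reaches ⟩
    mkState test3 (suc k) (a′ (suc k) + 1) y′ ℓ′ a′ (suc (c + tC))
      ≡⟨ cong (λ v → mkState test3 (suc k) v y′ ℓ′ a′ (suc (c + tC))) next-smallest ⟩
    mkState test3 (suc k) (suc x) y′ ℓ′ a′ (suc (c + tC)) ∎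
    where
    next-smallest : a′ (suc k) + 1 ≡ suc x
    next-smallest = trans (cong (_+ 1) (trans (a′-below (suc k) ≤-refl) (upd-same a (suc k) x)))
                          (+-comm x 1)
  below : ∀ j → j < suc k → a′ j ≡ a j
  below j j<sk = trans (a′-below j (m<n⇒m<1+n j<sk)) (upd-other a x (<⇒≢ j<sk))
  reads-total : suc (c + tC) + tD ≡ c + suc (tC + tD)
  reads-total = trans (cong suc (+-assoc c tC tD)) (sym (+-suc c (tC + tD)))

subtree : ∀ b {k x y ℓ a c r} → y ≤ b → 1 ≤ x → x + y ≡ r → Admissible x r →
  SubtreeRun (mkState test3 (suc k) x y ℓ a c) (suc k) x r a c
subtree b {x = x} {y} y≤b 1≤x refl adm with 2 * x ≤? y
... | no 2x≰y = subtree-leaf 1≤x adm 2x≰y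
subtree zero    {x = x} y≤0 1≤x refl adm | yes 2x≤y =
  contradiction (≤-trans 1≤x (≤-trans (m≤m+n x _) (≤-trans 2x≤y y≤0))) λ ()
subtree (suc b) {x = x} {y} y≤b 1≤x refl adm | yes 2x≤y = subtree-descend 1≤x 2x≤y
  (subtree b y-x≤b 1≤x (m+[n∸m]≡n (≤-trans (m≤m+n x _) 2x≤y)) (twice≤ 2x≤y))
  λ {y₁} sy₁≡y → subtree b (≤-pred (subst (_≤ suc b) (sym sy₁≡y) y≤b)) (s≤s z≤n)
                         (trans (sym (+-suc x y₁)) (cong (x +_) sy₁≡y)) (Admissible-next 1≤x 2x≤y)
  where
  y-x≤b : y ∸ x ≤ b
  y-x≤b = ≤-trans (∸-monoʳ-≤ y 1≤x) (∸-monoˡ-≤ 1 y≤b)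

theorem4p11 : (n : ℕ) → 1 ≤ n →
    ∃[ fuel ] ∃[ s ] (run fuel (initState n) ≡ just s × State.reads s + p[n-2] n ≡ p n)
theorem4p11 (suc n) _ with subtree n {0} {1} {n} {0} {λ _ → 0} {1} ≤-refl ≤-refl refl (Admissible-root n)
... | t , R , count =
  suc (duration + 1) ,
  mkState halt 1 x′ y′ ℓ′ a′ (suc t) ,
  run-halts (suc (duration + 1)) (initState (suc n))
    (trans (steps-+ duration 1 _) (cong step reaches)) ,
  trans (cong (suc t +_) (sym (p≥[n-2]-one (suc n)))) (trans count (p≥-one (suc n)))
  where open ReturnsTo R
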